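{- Let $n\ge 1$, let $A=\{a_1,\dots,a_n\}$ and $S$ the power set of $A$. For $u\in S$ let $f(u)=(s_1,\dots,s_n)\in\mathbb{Z}_2^n$, where $s_j\equiv \#\{i : a_i\in u,\ i\mid j\}\pmod 2$. Then $f:S\to\mathbb{Z}_2^n$ is injective, i.e. distinct $u_1,u_2\in S$ have distinct images.
   Context: Locker problem: $n$ lockers numbered $1,\dots,n$ and $n$ students $a_1,\dots,a_n$; initially all lockers closed; each student $a_i$ in a chosen subset $u$ toggles every locker whose number is a multiple of $i$. $f(u)$ records the final states ($1$ = open, $0$ = closed). -}

module Defs where

open import Data.Bool using (Bool; true; false; not)
open import Data.Nat using (ℕ; zero; suc)
open import Data.Nat.Divisibility using (_∣?_)
open import Data.Fin using (Fin; toℕ)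
open import Data.Fin.Subset using (Subset; _∩_; ∣_∣)
open import Data.Vec using (Vec; tabulate)
open import Relation.Nullary.Decidable using (does)

-- Reduction mod 2 of a natural number, as an element of ℤ₂ ≅ Bool
-- (true = 1 = open, false = 0 = closed).
parity : ℕ → Bool
parity zero    = false
parity (suc k) = not (parity k)

-- Index i : Fin n stands for student a_{i+1} and locker number i+1.
-- divisorsOf j = the set of students a_i with i ∣ j (1-based numbering).
divisorsOf : ∀ {n} → Fin n → Subset n
divisorsOf j = tabulate (λ i → does (suc (toℕ i) ∣? suc (toℕ j)))

f : ∀ {n} → Subset n → Vec Bool n
f u = tabulate (λ j → parity ∣ u ∩ divisorsOf j ∣)

module Submission where

-- The state of locker k is the parity of |u ∩ D_k|, where D_k is the set of
-- students whose number divides k.  Every divisor of k other than k itself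
-- is strictly smaller than k, while k ∈ D_k.  Hence, if u and v agree on all
-- students below k, the sets u ∩ D_k and v ∩ D_k can differ only at k, and
-- the parity of their sizes records exactly whether k ∈ u.  So equal images
-- f u ≡ f v force u and v to agree at k, and well-founded induction on k
-- (along the order of Fin) shows that they agree everywhere.

open import Defs
open import Data.Bool using (true; false; _∧_; _xor_)
open import Data.Bool.Properties
  using (∧-identityʳ; ∧-zeroʳ; xor-assoc; xor-comm; xor-same; xor-identityʳ)
open import Data.Nat using (ℕ; _≥_; suc)
open import Data.Nat.Divisibility using (_∣_; _∣?_; ∣⇒≤; ∣-refl)
open import Data.Nat.Properties using (≤∧≢⇒<; ≤-pred)
open import Data.Fin using (Fin; toℕ; zero; suc; _<_)
open import Data.Fin.Properties using (toℕ-injective)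
open import Data.Fin.Induction using (<-wellFounded)
open import Data.Fin.Subset using (Subset; _∩_; ∣_∣)
open import Data.Vec using (Vec; []; _∷_; lookup; tabulate)
open import Data.Vec.Properties using (lookup∘tabulate; tabulate∘lookup; tabulate-cong)
open import Induction.WellFounded using (Acc; acc)
open import Relation.Nullary.Decidable using (Dec; yes; no; does; dec-true)
open import Relation.Binary.PropositionalEquality
  using (_≡_; _≢_; refl; sym; trans; cong; module ≡-Reasoning)
open ≡-Reasoning

xor-cancelʳ : ∀ a b x → a xor x ≡ b xor x → a ≡ b
xor-cancelʳ a b x e = begin
  a                  ≡⟨ sym (xor-identityʳ a) ⟩
  a xor false        ≡⟨ cong (a xor_) (sym (xor-same x)) ⟩
  a xor (x xor x)    ≡⟨ sym (xor-assoc a x x) ⟩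
  (a xor x) xor x    ≡⟨ cong (_xor x) e ⟩
  (b xor x) xor x    ≡⟨ xor-assoc b x x ⟩
  b xor (x xor x)    ≡⟨ cong (b xor_) (xor-same x) ⟩
  b xor false        ≡⟨ xor-identityʳ b ⟩
  b                  ∎

xor-cancelˡ : ∀ x a b → x xor a ≡ x xor b → a ≡ b
xor-cancelˡ x a b e =
  xor-cancelʳ a b x (trans (xor-comm a x) (trans e (xor-comm x b)))

∧-congʳ-when : ∀ a b c → (c ≡ true → a ≡ b) → a ∧ c ≡ b ∧ c
∧-congʳ-when a b false _   = trans (∧-zeroʳ a) (sym (∧-zeroʳ b))
∧-congʳ-when a b true  a≡b = begin
  a ∧ true  ≡⟨ ∧-identityʳ a ⟩
  a         ≡⟨ a≡b refl ⟩
  b         ≡⟨ sym (∧-identityʳ b) ⟩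
  b ∧ true  ∎

parity-∷ : ∀ {n} a c (u d : Subset n) →
           parity ∣ (a ∷ u) ∩ (c ∷ d) ∣ ≡ (a ∧ c) xor parity ∣ u ∩ d ∣
parity-∷ true  true  u d = refl
parity-∷ true  false u d = refl
parity-∷ false true  u d = refl
parity-∷ false false u d = refl

AgreeOn : ∀ {n} → Subset n → Subset n → Subset n → Set
AgreeOn {n} d u v = ∀ (i : Fin n) → lookup d i ≡ true → lookup u i ≡ lookup v i

AgreeOnExcept : ∀ {n} → Subset n → Fin n → Subset n → Subset n → Set
AgreeOnExcept {n} d k u v =
  ∀ (i : Fin n) → lookup d i ≡ true → i ≢ k → lookup u i ≡ lookup v i

parity-congOn : ∀ {n} (d u v : Subset n) → AgreeOn d u v →
                parity ∣ u ∩ d ∣ ≡ parity ∣ v ∩ d ∣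
parity-congOn []      []      []      _     = refl
parity-congOn (c ∷ d) (a ∷ u) (b ∷ v) agree = begin
  parity ∣ (a ∷ u) ∩ (c ∷ d) ∣      ≡⟨ parity-∷ a c u d ⟩
  (a ∧ c) xor parity ∣ u ∩ d ∣      ≡⟨ cong (_xor parity ∣ u ∩ d ∣) (∧-congʳ-when a b c (agree zero)) ⟩
  (b ∧ c) xor parity ∣ u ∩ d ∣      ≡⟨ cong ((b ∧ c) xor_) (parity-congOn d u v (λ i → agree (suc i))) ⟩
  (b ∧ c) xor parity ∣ v ∩ d ∣      ≡⟨ sym (parity-∷ b c v d) ⟩
  parity ∣ (b ∷ v) ∩ (c ∷ d) ∣      ∎

parity-pins : ∀ {n} (d : Subset n) (k : Fin n) (u v : Subset n) →
              lookup d k ≡ true → AgreeOnExcept d k u v →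
              parity ∣ u ∩ d ∣ ≡ parity ∣ v ∩ d ∣ → lookup u k ≡ lookup v k
parity-pins (true ∷ d) zero (a ∷ u) (b ∷ v) refl agree same = begin
  a         ≡⟨ sym (∧-identityʳ a) ⟩
  a ∧ true  ≡⟨ xor-cancelʳ (a ∧ true) (b ∧ true) (parity ∣ u ∩ d ∣) heads ⟩
  b ∧ true  ≡⟨ ∧-identityʳ b ⟩
  b         ∎
  where
  tails : parity ∣ u ∩ d ∣ ≡ parity ∣ v ∩ d ∣
  tails = parity-congOn d u v (λ i i∈d → agree (suc i) i∈d (λ ()))
  heads : (a ∧ true) xor parity ∣ u ∩ d ∣ ≡ (b ∧ true) xor parity ∣ u ∩ d ∣
  heads = begin
    (a ∧ true) xor parity ∣ u ∩ d ∣   ≡⟨ sym (parity-∷ a true u d) ⟩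
    parity ∣ (a ∷ u) ∩ (true ∷ d) ∣  ≡⟨ same ⟩
    parity ∣ (b ∷ v) ∩ (true ∷ d) ∣  ≡⟨ parity-∷ b true v d ⟩
    (b ∧ true) xor parity ∣ v ∩ d ∣   ≡⟨ cong ((b ∧ true) xor_) (sym tails) ⟩
    (b ∧ true) xor parity ∣ u ∩ d ∣   ∎
parity-pins (c ∷ d) (suc k) (a ∷ u) (b ∷ v) k∈d agree same =
  parity-pins d k u v k∈d (λ i i∈d i≢k → agree (suc i) i∈d (λ { refl → i≢k refl }))
    (xor-cancelˡ (a ∧ c) (parity ∣ u ∩ d ∣) (parity ∣ v ∩ d ∣) (begin
      (a ∧ c) xor parity ∣ u ∩ d ∣   ≡⟨ sym (parity-∷ a c u d) ⟩
      parity ∣ (a ∷ u) ∩ (c ∷ d) ∣   ≡⟨ same ⟩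
      parity ∣ (b ∷ v) ∩ (c ∷ d) ∣   ≡⟨ parity-∷ b c v d ⟩
      (b ∧ c) xor parity ∣ v ∩ d ∣   ≡⟨ cong (_xor parity ∣ v ∩ d ∣) (sym heads) ⟩
      (a ∧ c) xor parity ∣ v ∩ d ∣   ∎))
  where
  heads : a ∧ c ≡ b ∧ c
  heads = ∧-congʳ-when a b c (λ c≡true → agree zero c≡true (λ ()))

does-true⇒ : ∀ {P : Set} (p? : Dec P) → does p? ≡ true → P
does-true⇒ (yes p) _  = p
does-true⇒ (no _)  ()

divisorsOf-∣ : ∀ {n} (i j : Fin n) → lookup (divisorsOf j) i ≡ true →
               suc (toℕ i) ∣ suc (toℕ j)
divisorsOf-∣ i j i∈Dj = does-true⇒ (suc (toℕ i) ∣? suc (toℕ j)) (begin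
  does (suc (toℕ i) ∣? suc (toℕ j))  ≡⟨ sym (lookup∘tabulate _ i) ⟩
  lookup (divisorsOf j) i            ≡⟨ i∈Dj ⟩
  true                               ∎)

divisorsOf-self : ∀ {n} (k : Fin n) → lookup (divisorsOf k) k ≡ true
divisorsOf-self k =
  trans (lookup∘tabulate _ k) (dec-true (suc (toℕ k) ∣? suc (toℕ k)) ∣-refl)

divisorsOf-below : ∀ {n} (i k : Fin n) → lookup (divisorsOf k) i ≡ true →
                   i ≢ k → i < k
divisorsOf-below i k i∈Dk i≢k =
  ≤∧≢⇒< (≤-pred (∣⇒≤ (divisorsOf-∣ i k i∈Dk))) (λ eq → i≢k (toℕ-injective eq))

lookup-f : ∀ {n} (u : Subset n) (k : Fin n) →
           lookup (f u) k ≡ parity ∣ u ∩ divisorsOf k ∣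
lookup-f u k = lookup∘tabulate _ k

-- Equal images force agreement at every k, by well-founded induction on k:
-- by induction u and v agree on the smaller divisors of k, so parity-pins
-- applies to d = D_k.
agree-below : ∀ {n} (u v : Subset n) → f u ≡ f v →
              ∀ k → Acc _<_ k → lookup u k ≡ lookup v k
agree-below u v fu≡fv k (acc smaller) =
  parity-pins (divisorsOf k) k u v (divisorsOf-self k) agree same
  where
  agree : AgreeOnExcept (divisorsOf k) k u v
  agree i i∈Dk i≢k =
    agree-below u v fu≡fv i (smaller (divisorsOf-below i k i∈Dk i≢k))
  same : parity ∣ u ∩ divisorsOf k ∣ ≡ parity ∣ v ∩ divisorsOf k ∣
  same = trans (sym (lookup-f u k)) (trans (cong (λ w → lookup w k) fu≡fv) (lookup-f v k))

lookup-ext : ∀ {A : Set} {n} (u v : Vec A n) → (∀ k → lookup u k ≡ lookup v k) → u ≡ v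
lookup-ext u v pointwise = begin
  u                   ≡⟨ sym (tabulate∘lookup u) ⟩
  tabulate (lookup u) ≡⟨ tabulate-cong pointwise ⟩
  tabulate (lookup v) ≡⟨ tabulate∘lookup v ⟩
  v                   ∎

corollary1 : (n : ℕ) → n ≥ 1 → (u₁ u₂ : Subset n) → f u₁ ≡ f u₂ → u₁ ≡ u₂
corollary1 n _ u₁ u₂ fu₁≡fu₂ =
  lookup-ext u₁ u₂ (λ k → agree-below u₁ u₂ fu₁≡fu₂ k (<-wellFounded k))
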